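{- Let $K$ be the absolute constant described in the context. There is an absolute constant $C$ such that the following holds. Let $Q=(V,E)$ be a component of $Q_{d,k}$, let $A\subseteq V$ with $|A|=|V|/2$ and $|\partial(A)|\le(1+\epsilon)\binom{d-1}{k-1}|A|$, and let $S$ be a coordinate cut in $Q$ with $|A\triangle S|\le K\epsilon2^d$. Then $$|\partial(A)\triangle\partial(S)|=|\partial(A\triangle S)|\le C\epsilon\binom{d-1}{k-1}|A|.$$
   Context: $Q_{d,k}$ is the graph on $\{0,1\}^d$ in which two vertices are adjacent iff their Hamming distance is exactly $k$. A component of $Q_{d,k}$ is: $Q_{d,k}$ itself if $k$ is odd; if $k$ is even, the subgraph induced by the vertices of even Hamming weight or by those of odd Hamming weight. For $T\subseteq V$, $\partial(T)$ is the set of edges of $Q$ with exactly one endpoint in $T$. A coordinate cut in $Q$ is a set $S_{j,b}\cap V$ with $S_{j,b}=\{x:x_j=b\}$. $K$ is an absolute constant with the property: for every integer $k$, every sufficiently large $d$, every component $Q=(V,E)$ of $Q_{d,k}$, every $\epsilon\ge0$ and every $A\subseteq V$ with $|A|=|V|/2$ and $|\partial(A)|\le(1+\epsilon)\binom{d-1}{k-1}|A|$, there is a coordinate cut $S$ in $Q$ with $|A\triangle S|\le K\epsilon 2^d$.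
   Formalization: The parameter ε and the constant K range over ℚ, and the constant C is taken in ℚ. -}

module Defs where

open import Data.Bool using (Bool; true; false; _∧_; _∨_; _xor_; not; if_then_else_; T)
open import Data.Nat using (ℕ; zero; suc; _+_; _*_; _∸_; _^_; _≡ᵇ_)
open import Data.Nat.Combinatorics using (_C_)
open import Data.Vec using (Vec; []; _∷_; lookup; zipWith)
open import Data.List using (List; []; _∷_; map; concatMap; _++_)
open import Data.Fin using (Fin)
open import Data.Product using (_×_; _,_)
open import Data.Integer using (+_)
open import Data.Rational using (ℚ; _/_)

ℕ→ℚ : ℕ → ℚ
ℕ→ℚ n = + n / 1

eqB : Bool → Bool → Bool
eqB a b = not (a xor b)

evenℕ : ℕ → Bool
evenℕ zero = true
evenℕ (suc n) = not (evenℕ n)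

allVecs : (d : ℕ) → List (Vec Bool d)
allVecs zero = [] ∷ []
allVecs (suc d) = map (false ∷_) (allVecs d) ++ map (true ∷_) (allVecs d)

count : {A : Set} → (A → Bool) → List A → ℕ
count p [] = 0
count p (x ∷ xs) = (if p x then 1 else 0) + count p xs

weight : {d : ℕ} → Vec Bool d → ℕ
weight [] = 0
weight (a ∷ x) = (if a then 1 else 0) + weight x

hamming : {d : ℕ} → Vec Bool d → Vec Bool d → ℕ
hamming x y = weight (zipWith _xor_ x y)

-- Components of Q_{d,k}: indexed by b : Bool.
-- If k is odd, the component is all of {0,1}^d (for either b).
-- If k is even, b = true selects even-weight vertices, b = false odd-weight ones.
inComp : {d : ℕ} → (k : ℕ) → (b : Bool) → Vec Bool d → Bool
inComp k b x = if evenℕ k then eqB (evenℕ (weight x)) b else true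

-- strict lexicographic order, used to list each (undirected) edge once
_<lex_ : {d : ℕ} → Vec Bool d → Vec Bool d → Bool
[] <lex [] = false
(a ∷ x) <lex (c ∷ y) = (not a ∧ c) ∨ (eqB a c ∧ (x <lex y))

edges : (d k : ℕ) → (b : Bool) → List (Vec Bool d × Vec Bool d)
edges d k b =
  concatMap (λ x → concatMap (λ y →
    if inComp k b x ∧ inComp k b y ∧ (hamming x y ≡ᵇ k) ∧ (x <lex y)
    then (x , y) ∷ [] else []) (allVecs d)) (allVecs d)

Subset : ℕ → Set
Subset d = Vec Bool d → Bool

card : {d : ℕ} → Subset d → ℕ
card {d} T = count T (allVecs d)

Vset : (d k : ℕ) → Bool → Subset d
Vset d k b x = inComp k b x

_⊆V[_,_] : {d : ℕ} → Subset d → ℕ → Bool → Set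
_⊆V[_,_] {d} A k b = (x : Vec Bool d) → T (A x) → T (inComp k b x)

_△_ : {d : ℕ} → Subset d → Subset d → Subset d
(A △ S) x = A x xor S x

inBoundary : {d : ℕ} → Subset d → Vec Bool d × Vec Bool d → Bool
inBoundary A (x , y) = A x xor A y

boundarySize : (d k : ℕ) → Bool → Subset d → ℕ
boundarySize d k b A = count (inBoundary A) (edges d k b)

boundarySymDiffSize : (d k : ℕ) → Bool → Subset d → Subset d → ℕ
boundarySymDiffSize d k b A S =
  count (λ e → inBoundary A e xor inBoundary S e) (edges d k b)

coordCut : {d : ℕ} → (k : ℕ) → Bool → Fin d → Bool → Subset d
coordCut k b j c x = eqB (lookup x j) c ∧ inComp k b x

module Submission where

-- Write D = A △ S for the cut S = {x_j = c} ∩ V and N = binom(d-1, k-1), the number of neighbours of a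
-- vertex that differ from it in coordinate j (all of them lie in V). Then |∂S| = N|S|, and checking edge by
-- edge, ∂D and ∂S are covered by ∂A together with at most 2N|D| edges that cross the cut at a vertex of D.
-- With |A| ≤ |S| + |D| this gives |∂D| + N|A| ≤ |∂A| + 3N|D|; inserting |∂A| ≤ (1+ε)N|A| and
-- |D| ≤ Kε2^d ≤ 4Kε|A| leaves |∂D| ≤ (1 + 12K)εN|A| (K replaced by max(K, 0)). The identity
-- ∂A △ ∂S = ∂(A △ S) holds edgewise.

open import Defs

module HammingGraph where
  open import Algebra.Bundles using (CommutativeMonoid; CommutativeRing)
  open import Data.Bool using (Bool; true; false; _∧_; _xor_; not; if_then_else_; T)
  open import Data.Unit using (tt)
  open import Data.Bool.Properties
    using (∧-assoc; ∧-comm; ∧-idem; ∧-zeroʳ; ∧-identityʳ; ∧-inverseʳ; ∧-commutativeMonoid; xor-comm; xor-same;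
           not-distribˡ-xor; not-injective; xor-∧-commutativeRing)
  open import Data.Fin using (Fin; zero; suc)
  open import Data.List using (List; []; _∷_; map; concatMap; _++_)
  open import Data.Nat using (ℕ; zero; suc; _+_; _*_; _∸_; _^_; _≡ᵇ_; _≤_; z≤n; s≤s)
  open import Data.Nat.Combinatorics using (_C_; nCk+nC[k+1]≡[n+1]C[k+1])
  open import Data.Nat.Properties
  open import Data.Product using (_×_; _,_)
  open import Data.Vec using (Vec; []; _∷_; lookup; zipWith)
  open import Data.Vec.Properties using (lookup-zipWith; zipWith-comm)
  open import Function using (_∘_)
  open import Relation.Binary.PropositionalEquality

  open import Algebra.Properties.CommutativeSemigroup +-commutativeSemigroup
    using () renaming (interchange to +-interchange)
  open import Algebra.Properties.CommutativeSemigroup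
    (CommutativeMonoid.commutativeSemigroup ∧-commutativeMonoid)
    using () renaming (interchange to ∧-interchange; x∙yz≈y∙xz to ∧-leftComm)
  open import Algebra.Properties.CommutativeSemigroup
    (CommutativeMonoid.commutativeSemigroup (CommutativeRing.+-commutativeMonoid xor-∧-commutativeRing))
    using () renaming (interchange to xor-interchange)

  ⟦_⟧ : Bool → ℕ
  ⟦ a ⟧ = if a then 1 else 0

  ⟦∧⟧ : ∀ a c → ⟦ a ∧ c ⟧ ≡ ⟦ a ⟧ * ⟦ c ⟧
  ⟦∧⟧ true  c = sym (+-identityʳ ⟦ c ⟧)
  ⟦∧⟧ false c = refl

  ⟦∧⟧≤⟦⟧ : ∀ a c → ⟦ a ∧ c ⟧ ≤ ⟦ a ⟧
  ⟦∧⟧≤⟦⟧ true  true  = ≤-refl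
  ⟦∧⟧≤⟦⟧ true  false = z≤n
  ⟦∧⟧≤⟦⟧ false c     = z≤n

  ⟦xor⟧ : ∀ a c → ⟦ a xor c ⟧ ≡ ⟦ a ∧ not c ⟧ + ⟦ c ∧ not a ⟧
  ⟦xor⟧ true  true  = refl
  ⟦xor⟧ true  false = refl
  ⟦xor⟧ false true  = refl
  ⟦xor⟧ false false = refl

  ∧-cong-if-true : ∀ a {c e} → (a ≡ true → c ≡ e) → a ∧ c ≡ a ∧ e
  ∧-cong-if-true true  c≡e = c≡e refl
  ∧-cong-if-true false _   = refl

  xor≡false⇒≡ : ∀ a c → a xor c ≡ false → a ≡ c
  xor≡false⇒≡ true  true  _ = refl
  xor≡false⇒≡ false false _ = refl

  eqB-xor-eqB : ∀ a a′ c → (eqB a c ∧ true) xor (eqB a′ c ∧ true) ≡ a xor a′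
  eqB-xor-eqB true  true  c     = xor-same (eqB true c ∧ true)
  eqB-xor-eqB false false c     = xor-same (eqB false c ∧ true)
  eqB-xor-eqB true  false true  = refl
  eqB-xor-eqB true  false false = refl
  eqB-xor-eqB false true  true  = refl
  eqB-xor-eqB false true  false = refl

  ∑ : {A : Set} → List A → (A → ℕ) → ℕ
  ∑ []       f = 0
  ∑ (x ∷ xs) f = f x + ∑ xs f

  syntax ∑ xs (λ x → e) = ∑[ x ∈ xs ] e

  module _ {A : Set} where

    count≡∑ : (p : A → Bool) (xs : List A) → count p xs ≡ ∑[ x ∈ xs ] ⟦ p x ⟧
    count≡∑ p []       = refl
    count≡∑ p (x ∷ xs) = cong (⟦ p x ⟧ +_) (count≡∑ p xs)

    ∑-cong : {f g : A → ℕ} → (∀ x → f x ≡ g x) → (xs : List A) → ∑ xs f ≡ ∑ xs g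
    ∑-cong f≡g []       = refl
    ∑-cong f≡g (x ∷ xs) = cong₂ _+_ (f≡g x) (∑-cong f≡g xs)

    ∑-mono-≤ : {f g : A → ℕ} → (∀ x → f x ≤ g x) → (xs : List A) → ∑ xs f ≤ ∑ xs g
    ∑-mono-≤ f≤g []       = z≤n
    ∑-mono-≤ f≤g (x ∷ xs) = +-mono-≤ (f≤g x) (∑-mono-≤ f≤g xs)

    ∑-zero : (xs : List A) → ∑[ x ∈ xs ] 0 ≡ 0
    ∑-zero []       = refl
    ∑-zero (x ∷ xs) = ∑-zero xs

    ∑-distrib-+ : (f g : A → ℕ) (xs : List A) → ∑[ x ∈ xs ] (f x + g x) ≡ ∑ xs f + ∑ xs g
    ∑-distrib-+ f g []       = refl
    ∑-distrib-+ f g (x ∷ xs) =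
      trans (cong (f x + g x +_) (∑-distrib-+ f g xs)) (+-interchange (f x) (g x) (∑ xs f) (∑ xs g))

    ∑-*ˡ : (n : ℕ) (f : A → ℕ) (xs : List A) → ∑[ x ∈ xs ] (n * f x) ≡ n * ∑ xs f
    ∑-*ˡ n f []       = sym (*-zeroʳ n)
    ∑-*ˡ n f (x ∷ xs) = trans (cong (n * f x +_) (∑-*ˡ n f xs)) (sym (*-distribˡ-+ n (f x) (∑ xs f)))

    ∑-*ʳ : (n : ℕ) (f : A → ℕ) (xs : List A) → ∑[ x ∈ xs ] (f x * n) ≡ ∑ xs f * n
    ∑-*ʳ n f xs = trans (∑-cong (λ x → *-comm (f x) n) xs) (trans (∑-*ˡ n f xs) (*-comm n (∑ xs f)))

    ∑-⟦∧⟧ : (a : Bool) (p : A → Bool) (xs : List A) → ∑[ x ∈ xs ] ⟦ a ∧ p x ⟧ ≡ ⟦ a ⟧ * ∑[ x ∈ xs ] ⟦ p x ⟧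
    ∑-⟦∧⟧ a p xs = trans (∑-cong (λ x → ⟦∧⟧ a (p x)) xs) (∑-*ˡ ⟦ a ⟧ (λ x → ⟦ p x ⟧) xs)

    ∑-if-singleton : (f : A → ℕ) (a : Bool) (e : A) → ∑ (if a then e ∷ [] else []) f ≡ ⟦ a ⟧ * f e
    ∑-if-singleton f true  e = refl
    ∑-if-singleton f false e = refl

    ∑-++ : (f : A → ℕ) (xs ys : List A) → ∑ (xs ++ ys) f ≡ ∑ xs f + ∑ ys f
    ∑-++ f []       ys = refl
    ∑-++ f (x ∷ xs) ys = trans (cong (f x +_) (∑-++ f xs ys)) (sym (+-assoc (f x) (∑ xs f) (∑ ys f)))

  module _ {A B : Set} where

    ∑-map : (f : B → ℕ) (g : A → B) (xs : List A) → ∑ (map g xs) f ≡ ∑[ x ∈ xs ] f (g x)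
    ∑-map f g []       = refl
    ∑-map f g (x ∷ xs) = cong (f (g x) +_) (∑-map f g xs)

    ∑-concatMap : (f : B → ℕ) (g : A → List B) (xs : List A) →
      ∑ (concatMap g xs) f ≡ ∑[ x ∈ xs ] ∑ (g x) f
    ∑-concatMap f g []       = refl
    ∑-concatMap f g (x ∷ xs) = trans (∑-++ f (g x) (concatMap g xs)) (cong (∑ (g x) f +_) (∑-concatMap f g xs))

    ∑-comm : (f : A → B → ℕ) (xs : List A) (ys : List B) →
      ∑[ x ∈ xs ] ∑[ y ∈ ys ] f x y ≡ ∑[ y ∈ ys ] ∑[ x ∈ xs ] f x y
    ∑-comm f []       ys = sym (∑-zero ys)
    ∑-comm f (x ∷ xs) ys = trans (cong (∑ ys (f x) +_) (∑-comm f xs ys))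
      (sym (∑-distrib-+ (f x) (λ y → ∑[ x′ ∈ xs ] f x′ y) ys))

  _⊕_ : ∀ {d} → Vec Bool d → Vec Bool d → Vec Bool d
  _⊕_ = zipWith _xor_

  ∑-allVecs-suc : ∀ d (f : Vec Bool (suc d) → ℕ) →
    ∑ (allVecs (suc d)) f ≡ ∑[ x ∈ allVecs d ] f (false ∷ x) + ∑[ x ∈ allVecs d ] f (true ∷ x)
  ∑-allVecs-suc d f = trans (∑-++ f (map (false ∷_) (allVecs d)) (map (true ∷_) (allVecs d)))
    (cong₂ _+_ (∑-map f (false ∷_) (allVecs d)) (∑-map f (true ∷_) (allVecs d)))

  ∑-allVecs-⊕ : ∀ {d} (x : Vec Bool d) (f : Vec Bool d → ℕ) → ∑[ y ∈ allVecs d ] f (x ⊕ y) ≡ ∑ (allVecs d) f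
  ∑-allVecs-⊕ []               f = refl
  ∑-allVecs-⊕ {suc d} (false ∷ x) f = begin
    ∑[ y ∈ allVecs (suc d) ] f ((false ∷ x) ⊕ y)
      ≡⟨ ∑-allVecs-suc d _ ⟩
    ∑[ y ∈ allVecs d ] f (false ∷ x ⊕ y) + ∑[ y ∈ allVecs d ] f (true ∷ x ⊕ y)
      ≡⟨ cong₂ _+_ (∑-allVecs-⊕ x (f ∘ (false ∷_))) (∑-allVecs-⊕ x (f ∘ (true ∷_))) ⟩
    ∑[ y ∈ allVecs d ] f (false ∷ y) + ∑[ y ∈ allVecs d ] f (true ∷ y)
      ≡⟨ ∑-allVecs-suc d f ⟨
    ∑ (allVecs (suc d)) f ∎
    where open ≡-Reasoning
  ∑-allVecs-⊕ {suc d} (true ∷ x) f = begin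
    ∑[ y ∈ allVecs (suc d) ] f ((true ∷ x) ⊕ y)
      ≡⟨ ∑-allVecs-suc d _ ⟩
    ∑[ y ∈ allVecs d ] f (true ∷ x ⊕ y) + ∑[ y ∈ allVecs d ] f (false ∷ x ⊕ y)
      ≡⟨ cong₂ _+_ (∑-allVecs-⊕ x (f ∘ (true ∷_))) (∑-allVecs-⊕ x (f ∘ (false ∷_))) ⟩
    ∑[ y ∈ allVecs d ] f (true ∷ y) + ∑[ y ∈ allVecs d ] f (false ∷ y)
      ≡⟨ +-comm (∑[ y ∈ allVecs d ] f (true ∷ y)) _ ⟩
    ∑[ y ∈ allVecs d ] f (false ∷ y) + ∑[ y ∈ allVecs d ] f (true ∷ y)
      ≡⟨ ∑-allVecs-suc d f ⟨
    ∑ (allVecs (suc d)) f ∎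
    where open ≡-Reasoning

  ∑-weight≡ : ∀ d k → ∑[ z ∈ allVecs d ] ⟦ weight z ≡ᵇ k ⟧ ≡ d C k
  ∑-weight≡ zero    zero    = refl
  ∑-weight≡ zero    (suc k) = refl
  ∑-weight≡ (suc d) zero    =
    trans (∑-allVecs-suc d _) (cong₂ _+_ (∑-weight≡ d 0) (∑-zero (allVecs d)))
  ∑-weight≡ (suc d) (suc k) =
    trans (∑-allVecs-suc d _)
      (trans (cong₂ _+_ (∑-weight≡ d (suc k)) (∑-weight≡ d k))
        (trans (+-comm (d C suc k) (d C k)) (nCk+nC[k+1]≡[n+1]C[k+1] d k)))

  weight≡0⇒lookup≡false : ∀ {d} (z : Vec Bool d) j → (weight z ≡ᵇ 0) ∧ lookup z j ≡ false
  weight≡0⇒lookup≡false (true  ∷ z) j       = refl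
  weight≡0⇒lookup≡false (false ∷ z) zero    = ∧-zeroʳ (weight z ≡ᵇ 0)
  weight≡0⇒lookup≡false (false ∷ z) (suc j) = weight≡0⇒lookup≡false z j

  ∑-weight≡-lookup : ∀ d (j : Fin (suc d)) k →
    ∑[ z ∈ allVecs (suc d) ] ⟦ (weight z ≡ᵇ suc k) ∧ lookup z j ⟧ ≡ d C k
  ∑-weight≡-lookup d zero k =
    trans (∑-allVecs-suc d _)
      (cong₂ _+_ (trans (∑-cong (λ z → cong ⟦_⟧ (∧-zeroʳ _)) (allVecs d)) (∑-zero (allVecs d)))
                 (trans (∑-cong (λ z → cong ⟦_⟧ (∧-identityʳ _)) (allVecs d)) (∑-weight≡ d k)))
  ∑-weight≡-lookup (suc d) (suc j) zero =
    trans (∑-allVecs-suc (suc d) _)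
      (cong₂ _+_ (∑-weight≡-lookup d j zero)
                 (trans (∑-cong (λ z → cong ⟦_⟧ (weight≡0⇒lookup≡false z j)) (allVecs (suc d)))
                        (∑-zero (allVecs (suc d)))))
  ∑-weight≡-lookup (suc d) (suc j) (suc k) =
    trans (∑-allVecs-suc (suc d) _)
      (trans (cong₂ _+_ (∑-weight≡-lookup d j (suc k)) (∑-weight≡-lookup d j k))
        (trans (+-comm (d C suc k) (d C k)) (nCk+nC[k+1]≡[n+1]C[k+1] d k)))

  ∑-allVecs-1 : ∀ d → ∑[ x ∈ allVecs d ] 1 ≡ 2 ^ d
  ∑-allVecs-1 zero    = refl
  ∑-allVecs-1 (suc d) =
    trans (∑-allVecs-suc d (λ _ → 1))
      (trans (cong₂ _+_ (∑-allVecs-1 d) (∑-allVecs-1 d)) (cong (2 ^ d +_) (sym (+-identityʳ (2 ^ d)))))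

  -- Parity and the components

  oddℕ : ℕ → Bool
  oddℕ n = not (evenℕ n)

  oddℕ-+ : ∀ m n → oddℕ (m + n) ≡ oddℕ m xor oddℕ n
  oddℕ-+ zero    n = refl
  oddℕ-+ (suc m) n = trans (cong not (oddℕ-+ m n)) (not-distribˡ-xor (oddℕ m) (oddℕ n))

  oddℕ-⟦⟧ : ∀ a → oddℕ ⟦ a ⟧ ≡ a
  oddℕ-⟦⟧ true  = refl
  oddℕ-⟦⟧ false = refl

  oddℕ-weight-⊕ : ∀ {d} (x y : Vec Bool d) → oddℕ (weight (x ⊕ y)) ≡ oddℕ (weight x) xor oddℕ (weight y)
  oddℕ-weight-⊕ []      []      = refl
  oddℕ-weight-⊕ (a ∷ x) (c ∷ y) = begin
    oddℕ (⟦ a xor c ⟧ + weight (x ⊕ y))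
      ≡⟨ oddℕ-+ ⟦ a xor c ⟧ (weight (x ⊕ y)) ⟩
    oddℕ ⟦ a xor c ⟧ xor oddℕ (weight (x ⊕ y))
      ≡⟨ cong₂ _xor_ (oddℕ-⟦⟧ (a xor c)) (oddℕ-weight-⊕ x y) ⟩
    (a xor c) xor (oddℕ (weight x) xor oddℕ (weight y))
      ≡⟨ xor-interchange a c (oddℕ (weight x)) (oddℕ (weight y)) ⟩
    (a xor oddℕ (weight x)) xor (c xor oddℕ (weight y))
      ≡⟨ cong₂ (λ u v → (u xor oddℕ (weight x)) xor (v xor oddℕ (weight y))) (oddℕ-⟦⟧ a) (oddℕ-⟦⟧ c) ⟨
    (oddℕ ⟦ a ⟧ xor oddℕ (weight x)) xor (oddℕ ⟦ c ⟧ xor oddℕ (weight y))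
      ≡⟨ cong₂ _xor_ (oddℕ-+ ⟦ a ⟧ (weight x)) (oddℕ-+ ⟦ c ⟧ (weight y)) ⟨
    oddℕ (⟦ a ⟧ + weight x) xor oddℕ (⟦ c ⟧ + weight y) ∎
    where open ≡-Reasoning

  inComp-closed : ∀ {d} k b (x y : Vec Bool d) → inComp k b x ≡ true → hamming x y ≡ k → inComp k b y ≡ true
  inComp-closed k b x y x∈V refl with evenℕ (hamming x y) in even
  ... | false = refl
  ... | true  = trans (cong (λ e → eqB e b) (sym same-parity)) x∈V
    where
    same-parity : evenℕ (weight x) ≡ evenℕ (weight y)
    same-parity = not-injective (xor≡false⇒≡ (oddℕ (weight x)) (oddℕ (weight y))
      (trans (sym (oddℕ-weight-⊕ x y)) (cong not even)))

  inComp-cover : ∀ e w b → 1 ≤ ⟦ if e then eqB w b else true ⟧ + ⟦ if e then eqB (not w) b else true ⟧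
  inComp-cover true  true  true  = ≤-refl
  inComp-cover true  true  false = ≤-refl
  inComp-cover true  false true  = ≤-refl
  inComp-cover true  false false = ≤-refl
  inComp-cover false w     b     = s≤s z≤n

  2^d≤card-Vset : ∀ d k b → 2 ^ d ≤ card (Vset (suc d) k b)
  2^d≤card-Vset d k b = begin
    2 ^ d
      ≡⟨ ∑-allVecs-1 d ⟨
    ∑[ x ∈ allVecs d ] 1
      ≤⟨ ∑-mono-≤ (λ x → inComp-cover (evenℕ k) (evenℕ (weight x)) b) (allVecs d) ⟩
    ∑[ x ∈ allVecs d ] (⟦ inComp k b (false ∷ x) ⟧ + ⟦ inComp k b (true ∷ x) ⟧)
      ≡⟨ ∑-distrib-+ _ _ (allVecs d) ⟩
    ∑[ x ∈ allVecs d ] ⟦ inComp k b (false ∷ x) ⟧ + ∑[ x ∈ allVecs d ] ⟦ inComp k b (true ∷ x) ⟧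
      ≡⟨ ∑-allVecs-suc d (λ x → ⟦ inComp k b x ⟧) ⟨
    ∑[ x ∈ allVecs (suc d) ] ⟦ inComp k b x ⟧
      ≡⟨ count≡∑ (inComp k b) (allVecs (suc d)) ⟨
    card (Vset (suc d) k b) ∎
    where open ≤-Reasoning

  2^[1+d]≤4*card : ∀ d k b (A : Subset (suc d)) → 2 * card A ≡ card (Vset (suc d) k b) → 2 ^ suc d ≤ 4 * card A
  2^[1+d]≤4*card d k b A 2|A|≡|V| = begin
    2 * 2 ^ d                   ≤⟨ *-monoʳ-≤ 2 (2^d≤card-Vset d k b) ⟩
    2 * card (Vset (suc d) k b) ≡⟨ cong (2 *_) 2|A|≡|V| ⟨
    2 * (2 * card A)            ≡⟨ *-assoc 2 2 (card A) ⟨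
    4 * card A                  ∎
    where open ≤-Reasoning

  -- Boundaries as sums over ordered adjacent pairs

  module _ {d : ℕ} where

    ∑² : (Vec Bool d → Vec Bool d → ℕ) → ℕ
    ∑² f = ∑[ x ∈ allVecs d ] ∑[ y ∈ allVecs d ] f x y

    ∑²-cong : {f g : Vec Bool d → Vec Bool d → ℕ} → (∀ x y → f x y ≡ g x y) → ∑² f ≡ ∑² g
    ∑²-cong f≡g = ∑-cong (λ x → ∑-cong (f≡g x) (allVecs d)) (allVecs d)

    ∑²-distrib-+ : (f g : Vec Bool d → Vec Bool d → ℕ) → ∑² (λ x y → f x y + g x y) ≡ ∑² f + ∑² g
    ∑²-distrib-+ f g = trans (∑-cong (λ x → ∑-distrib-+ (f x) (g x) (allVecs d)) (allVecs d))
      (∑-distrib-+ (λ x → ∑ (allVecs d) (f x)) (λ x → ∑ (allVecs d) (g x)) (allVecs d))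

    ∑²-flip : (f : Vec Bool d → Vec Bool d → ℕ) → ∑² f ≡ ∑² (λ x y → f y x)
    ∑²-flip f = ∑-comm f (allVecs d) (allVecs d)

  hamming-comm : ∀ {d} (x y : Vec Bool d) → hamming x y ≡ hamming y x
  hamming-comm x y = cong weight (zipWith-comm xor-comm x y)

  <lex-split : ∀ {d} (n : Vec Bool d → Vec Bool d → ℕ) → (∀ x → n x x ≡ 0) → ∀ x y →
    ⟦ x <lex y ⟧ * n x y + ⟦ y <lex x ⟧ * n x y ≡ n x y
  <lex-split n n≡0 []          []          = sym (n≡0 [])
  <lex-split n n≡0 (false ∷ x) (true ∷ y)  = trans (+-identityʳ _) (+-identityʳ _)
  <lex-split n n≡0 (true ∷ x)  (false ∷ y) = +-identityʳ _
  <lex-split n n≡0 (false ∷ x) (false ∷ y) =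
    <lex-split (λ u v → n (false ∷ u) (false ∷ v)) (λ u → n≡0 (false ∷ u)) x y
  <lex-split n n≡0 (true ∷ x)  (true ∷ y)  =
    <lex-split (λ u v → n (true ∷ u) (true ∷ v)) (λ u → n≡0 (true ∷ u)) x y

  module _ {d : ℕ} (k : ℕ) (b : Bool) where

    adjacent : Vec Bool d → Vec Bool d → Bool
    adjacent x y = inComp k b x ∧ inComp k b y ∧ (hamming x y ≡ᵇ k)

    adjacent-comm : ∀ x y → adjacent x y ≡ adjacent y x
    adjacent-comm x y = trans (cong (λ h → inComp k b x ∧ inComp k b y ∧ (h ≡ᵇ k)) (hamming-comm x y))
      (∧-leftComm (inComp k b x) (inComp k b y) (hamming y x ≡ᵇ k))

    adjacent≡ : ∀ x y → adjacent x y ≡ inComp k b x ∧ (hamming x y ≡ᵇ k)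
    adjacent≡ x y with inComp k b x in x∈V | hamming x y ≡ᵇ k in dist
    ... | false | _     = refl
    ... | true  | false = ∧-zeroʳ (inComp k b y)
    ... | true  | true  = cong (_∧ true)
      (inComp-closed k b x y x∈V (≡ᵇ⇒≡ (hamming x y) k (subst T (sym dist) tt)))

    adjacent⇒inComp : ∀ x y → adjacent x y ≡ true → inComp k b x ≡ true × inComp k b y ≡ true
    adjacent⇒inComp x y adj with inComp k b x | inComp k b y
    ... | true | true = refl , refl

    ∑-edges-unfold : (f : Vec Bool d × Vec Bool d → ℕ) →
      ∑ (edges d k b) f ≡ ∑² (λ x y → ⟦ adjacent x y ∧ x <lex y ⟧ * f (x , y))
    ∑-edges-unfold f =
      trans (∑-concatMap f _ (allVecs d))
        (∑-cong (λ x → trans (∑-concatMap f _ (allVecs d))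
          (∑-cong (λ y → trans (∑-if-singleton f (listed x y) (x , y))
                               (cong (λ a → ⟦ a ⟧ * f (x , y)) (listed≡ x y)))
            (allVecs d))) (allVecs d))
      where
      listed : Vec Bool d → Vec Bool d → Bool
      listed x y = inComp k b x ∧ inComp k b y ∧ (hamming x y ≡ᵇ k) ∧ x <lex y

      listed≡ : ∀ x y → listed x y ≡ adjacent x y ∧ x <lex y
      listed≡ x y = sym (trans (∧-assoc (inComp k b x) _ (x <lex y))
                               (cong (inComp k b x ∧_) (∧-assoc (inComp k b y) _ (x <lex y))))

    ∑-edges : (g : Vec Bool d → Vec Bool d → Bool) → (∀ x → g x x ≡ false) →
      ∑ (edges d k b) (λ (x , y) → ⟦ g x y ⟧ + ⟦ g y x ⟧) ≡ ∑² (λ x y → ⟦ adjacent x y ∧ g x y ⟧)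
    ∑-edges g g≡false = begin
      ∑ (edges d k b) (λ (x , y) → ⟦ g x y ⟧ + ⟦ g y x ⟧)
        ≡⟨ ∑-edges-unfold _ ⟩
      ∑² (λ x y → ⟦ adjacent x y ∧ x <lex y ⟧ * (⟦ g x y ⟧ + ⟦ g y x ⟧))
        ≡⟨ ∑²-cong (λ x y → *-distribˡ-+ ⟦ adjacent x y ∧ x <lex y ⟧ ⟦ g x y ⟧ ⟦ g y x ⟧) ⟩
      ∑² (λ x y → forward x y + backward x y)
        ≡⟨ ∑²-distrib-+ forward backward ⟩
      ∑² forward + ∑² backward
        ≡⟨ cong (∑² forward +_) (∑²-flip backward) ⟩
      ∑² forward + ∑² (λ x y → backward y x)
        ≡⟨ ∑²-distrib-+ forward (λ x y → backward y x) ⟨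
      ∑² (λ x y → forward x y + backward y x)
        ≡⟨ ∑²-cong both-orientations ⟩
      ∑² (λ x y → ⟦ adjacent x y ∧ g x y ⟧) ∎
      where
      open ≡-Reasoning
      forward backward : Vec Bool d → Vec Bool d → ℕ
      forward  x y = ⟦ adjacent x y ∧ x <lex y ⟧ * ⟦ g x y ⟧
      backward x y = ⟦ adjacent x y ∧ x <lex y ⟧ * ⟦ g y x ⟧

      both-orientations : ∀ x y → forward x y + backward y x ≡ ⟦ adjacent x y ∧ g x y ⟧
      both-orientations x y rewrite adjacent-comm y x with adjacent x y
      ... | true  = <lex-split (λ u v → ⟦ g u v ⟧) (λ u → cong ⟦_⟧ (g≡false u)) x y
      ... | false = refl

    boundarySize≡∑² : (A : Subset d) → boundarySize d k b A ≡ ∑² (λ x y → ⟦ adjacent x y ∧ (A x ∧ not (A y)) ⟧)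
    boundarySize≡∑² A =
      trans (count≡∑ (inBoundary A) (edges d k b))
        (trans (∑-cong (λ (x , y) → ⟦xor⟧ (A x) (A y)) (edges d k b))
          (∑-edges (λ x y → A x ∧ not (A y)) (λ x → ∧-inverseʳ (A x))))

    adjacent⇒hamming≡ : ∀ x y → adjacent x y ≡ true → hamming x y ≡ k
    adjacent⇒hamming≡ x y adj with inComp k b x | inComp k b y | hamming x y ≡ᵇ k in dist
    ... | true | true | true = ≡ᵇ⇒≡ (hamming x y) k (subst T (sym dist) tt)

  hamming≡0⇒≡ : ∀ {d} (x y : Vec Bool d) → hamming x y ≡ 0 → x ≡ y
  hamming≡0⇒≡ []          []          _ = refl
  hamming≡0⇒≡ (true  ∷ x) (true  ∷ y) h = cong (true ∷_) (hamming≡0⇒≡ x y h)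
  hamming≡0⇒≡ (false ∷ x) (false ∷ y) h = cong (false ∷_) (hamming≡0⇒≡ x y h)

  boundarySize-k≡0 : ∀ d b (A : Subset d) → boundarySize d 0 b A ≡ 0
  boundarySize-k≡0 d b A = begin
    boundarySize d 0 b A
      ≡⟨ boundarySize≡∑² 0 b A ⟩
    ∑² (λ x y → ⟦ adjacent 0 b x y ∧ (A x ∧ not (A y)) ⟧)
      ≡⟨ ∑²-cong {d} (λ x y → cong ⟦_⟧ (trans (∧-cong-if-true (adjacent 0 b x y) (loop x y)) (∧-zeroʳ _))) ⟩
    ∑² {d} (λ _ _ → 0)
      ≡⟨ trans (∑-cong (λ _ → ∑-zero (allVecs d)) (allVecs d)) (∑-zero (allVecs d)) ⟩
    0 ∎
    where
    open ≡-Reasoning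
    loop : ∀ x y → adjacent 0 b x y ≡ true → A x ∧ not (A y) ≡ false
    loop x y adj rewrite hamming≡0⇒≡ x y (adjacent⇒hamming≡ 0 b x y adj) = ∧-inverseʳ (A y)

  module _ {d : ℕ} (k : ℕ) (b : Bool) where

    boundarySymDiffSize≡boundarySize-△ : (A S : Subset d) →
      boundarySymDiffSize d k b A S ≡ boundarySize d k b (A △ S)
    boundarySymDiffSize≡boundarySize-△ A S =
      trans (count≡∑ _ (edges d k b))
        (trans (∑-cong (λ (x , y) → cong ⟦_⟧ (xor-interchange (A x) (A y) (S x) (S y))) (edges d k b))
          (sym (count≡∑ _ (edges d k b))))

    -- Edgewise: an edge counted on the left but not in ∂A crosses ∂S and has an endpoint in A △ S.
    boundary-△-≤ : (A S : Subset d) →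
      boundarySize d k b (A △ S) + boundarySize d k b S ≤
        boundarySize d k b A + 2 * ∑² (λ x y → ⟦ adjacent k b x y ∧ ((A △ S) x ∧ (S x xor S y)) ⟧)
    boundary-△-≤ A S = begin
      boundarySize d k b (A △ S) + boundarySize d k b S
        ≡⟨ cong₂ _+_ (count≡∑ (inBoundary (A △ S)) E) (count≡∑ (inBoundary S) E) ⟩
      ∑[ e ∈ E ] ⟦ inBoundary (A △ S) e ⟧ + ∑[ e ∈ E ] ⟦ inBoundary S e ⟧
        ≡⟨ ∑-distrib-+ (λ e → ⟦ inBoundary (A △ S) e ⟧) (λ e → ⟦ inBoundary S e ⟧) E ⟨
      ∑[ e ∈ E ] (⟦ inBoundary (A △ S) e ⟧ + ⟦ inBoundary S e ⟧)
        ≤⟨ ∑-mono-≤ (λ (x , y) → edge-△-≤ (A x) (S x) (A y) (S y)) E ⟩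
      ∑[ e ∈ E ] (⟦ inBoundary A e ⟧ + 2 * crossings e)
        ≡⟨ ∑-distrib-+ (λ e → ⟦ inBoundary A e ⟧) (λ e → 2 * crossings e) E ⟩
      ∑[ e ∈ E ] ⟦ inBoundary A e ⟧ + ∑[ e ∈ E ] (2 * crossings e)
        ≡⟨ cong₂ _+_ (count≡∑ (inBoundary A) E) (sym (∑-*ˡ 2 crossings E)) ⟨
      boundarySize d k b A + 2 * ∑ E crossings
        ≡⟨ cong (λ n → boundarySize d k b A + 2 * n) (∑-edges k b h h-diagonal) ⟩
      boundarySize d k b A + 2 * ∑² (λ x y → ⟦ adjacent k b x y ∧ h x y ⟧) ∎
      where
      open ≤-Reasoning
      E : List (Vec Bool d × Vec Bool d)
      E = edges d k b

      h : Vec Bool d → Vec Bool d → Bool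
      h x y = (A △ S) x ∧ (S x xor S y)

      h-diagonal : ∀ x → h x x ≡ false
      h-diagonal x = trans (cong ((A △ S) x ∧_) (xor-same (S x))) (∧-zeroʳ _)

      crossings : Vec Bool d × Vec Bool d → ℕ
      crossings (x , y) = ⟦ h x y ⟧ + ⟦ h y x ⟧

      edge-△-≤ : ∀ a s a′ s′ →
        ⟦ (a xor s) xor (a′ xor s′) ⟧ + ⟦ s xor s′ ⟧ ≤
          ⟦ a xor a′ ⟧ + 2 * (⟦ (a xor s) ∧ (s xor s′) ⟧ + ⟦ (a′ xor s′) ∧ (s′ xor s) ⟧)
      edge-△-≤ false false false false = ≤ᵇ⇒≤ _ _ tt
      edge-△-≤ false false false true  = ≤ᵇ⇒≤ _ _ tt
      edge-△-≤ false false true  false = ≤ᵇ⇒≤ _ _ tt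
      edge-△-≤ false false true  true  = ≤ᵇ⇒≤ _ _ tt
      edge-△-≤ false true  false false = ≤ᵇ⇒≤ _ _ tt
      edge-△-≤ false true  false true  = ≤ᵇ⇒≤ _ _ tt
      edge-△-≤ false true  true  false = ≤ᵇ⇒≤ _ _ tt
      edge-△-≤ false true  true  true  = ≤ᵇ⇒≤ _ _ tt
      edge-△-≤ true  false false false = ≤ᵇ⇒≤ _ _ tt
      edge-△-≤ true  false false true  = ≤ᵇ⇒≤ _ _ tt
      edge-△-≤ true  false true  false = ≤ᵇ⇒≤ _ _ tt
      edge-△-≤ true  false true  true  = ≤ᵇ⇒≤ _ _ tt
      edge-△-≤ true  true  false false = ≤ᵇ⇒≤ _ _ tt
      edge-△-≤ true  true  false true  = ≤ᵇ⇒≤ _ _ tt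
      edge-△-≤ true  true  true  false = ≤ᵇ⇒≤ _ _ tt
      edge-△-≤ true  true  true  true  = ≤ᵇ⇒≤ _ _ tt

  card≤card+card-△ : ∀ {d} (A S : Subset d) → card A ≤ card S + card (A △ S)
  card≤card+card-△ {d} A S = begin
    card A
      ≡⟨ count≡∑ A (allVecs d) ⟩
    ∑[ x ∈ allVecs d ] ⟦ A x ⟧
      ≤⟨ ∑-mono-≤ (λ x → pointwise (A x) (S x)) (allVecs d) ⟩
    ∑[ x ∈ allVecs d ] (⟦ S x ⟧ + ⟦ (A △ S) x ⟧)
      ≡⟨ ∑-distrib-+ (λ x → ⟦ S x ⟧) (λ x → ⟦ (A △ S) x ⟧) (allVecs d) ⟩
    ∑[ x ∈ allVecs d ] ⟦ S x ⟧ + ∑[ x ∈ allVecs d ] ⟦ (A △ S) x ⟧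
      ≡⟨ cong₂ _+_ (count≡∑ S (allVecs d)) (count≡∑ (A △ S) (allVecs d)) ⟨
    card S + card (A △ S) ∎
    where
    open ≤-Reasoning
    pointwise : ∀ a s → ⟦ a ⟧ ≤ ⟦ s ⟧ + ⟦ a xor s ⟧
    pointwise true  true  = s≤s z≤n
    pointwise true  false = s≤s z≤n
    pointwise false s     = z≤n

  -- Coordinate cuts

  module _ {d : ℕ} (k : ℕ) (b : Bool) (j : Fin (suc d)) (c : Bool) where

    private
      V : Set
      V = Vec Bool (suc d)

      S : Subset (suc d)
      S = coordCut (suc k) b j c

      adj : V → V → Bool
      adj = adjacent (suc k) b

    crossesAt : V → V → Bool
    crossesAt x y = (hamming x y ≡ᵇ suc k) ∧ (lookup x j xor lookup y j)

    ∑-crossesAt : ∀ x → ∑[ y ∈ allVecs (suc d) ] ⟦ crossesAt x y ⟧ ≡ d C k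
    ∑-crossesAt x =
      trans (∑-cong (λ y → cong (λ t → ⟦ (hamming x y ≡ᵇ suc k) ∧ t ⟧) (sym (lookup-zipWith _xor_ j x y)))
                    (allVecs (suc d)))
        (trans (∑-allVecs-⊕ x (λ z → ⟦ (weight z ≡ᵇ suc k) ∧ lookup z j ⟧)) (∑-weight≡-lookup d j k))

    coordCut-xor : ∀ x y → adj x y ≡ true → S x xor S y ≡ lookup x j xor lookup y j
    coordCut-xor x y xy with adjacent⇒inComp (suc k) b x y xy
    ... | x∈V , y∈V =
      trans (cong₂ (λ u v → (eqB (lookup x j) c ∧ u) xor (eqB (lookup y j) c ∧ v)) x∈V y∈V)
            (eqB-xor-eqB (lookup x j) (lookup y j) c)

    -- Inside the component, the neighbours of x across the cut are exactly those differing from x in coordinate j.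
    ∑-adjacent-across : (A : Subset (suc d)) (x : V) →
      ∑[ y ∈ allVecs (suc d) ] ⟦ adj x y ∧ (A x ∧ (S x xor S y)) ⟧ ≡ ⟦ A x ∧ inComp (suc k) b x ⟧ * (d C k)
    ∑-adjacent-across A x =
      trans (∑-cong (λ y → cong ⟦_⟧ (across y)) (allVecs (suc d)))
        (trans (∑-⟦∧⟧ (A x ∧ inComp (suc k) b x) (crossesAt x) (allVecs (suc d)))
          (cong (⟦ A x ∧ inComp (suc k) b x ⟧ *_) (∑-crossesAt x)))
      where
      across : ∀ y → adj x y ∧ (A x ∧ (S x xor S y)) ≡ (A x ∧ inComp (suc k) b x) ∧ crossesAt x y
      across y = begin
        adj x y ∧ (A x ∧ (S x xor S y))
          ≡⟨ ∧-cong-if-true (adj x y) (cong (A x ∧_) ∘ coordCut-xor x y) ⟩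
        adj x y ∧ (A x ∧ (lookup x j xor lookup y j))
          ≡⟨ cong (_∧ (A x ∧ (lookup x j xor lookup y j))) (adjacent≡ (suc k) b x y) ⟩
        (inComp (suc k) b x ∧ (hamming x y ≡ᵇ suc k)) ∧ (A x ∧ (lookup x j xor lookup y j))
          ≡⟨ ∧-interchange (inComp (suc k) b x) _ (A x) _ ⟩
        (inComp (suc k) b x ∧ A x) ∧ crossesAt x y
          ≡⟨ cong (_∧ crossesAt x y) (∧-comm (inComp (suc k) b x) (A x)) ⟩
        (A x ∧ inComp (suc k) b x) ∧ crossesAt x y ∎
        where open ≡-Reasoning

    boundarySize-coordCut : boundarySize (suc d) (suc k) b S ≡ card S * (d C k)
    boundarySize-coordCut = begin
      boundarySize (suc d) (suc k) b S
        ≡⟨ boundarySize≡∑² (suc k) b S ⟩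
      ∑² (λ x y → ⟦ adj x y ∧ (S x ∧ not (S y)) ⟧)
        ≡⟨ ∑²-cong (λ x y → cong (λ t → ⟦ adj x y ∧ t ⟧) (∧-not≡∧-xor (S x) (S y))) ⟩
      ∑² (λ x y → ⟦ adj x y ∧ (S x ∧ (S x xor S y)) ⟧)
        ≡⟨ ∑-cong (∑-adjacent-across S) (allVecs (suc d)) ⟩
      ∑[ x ∈ allVecs (suc d) ] (⟦ S x ∧ inComp (suc k) b x ⟧ * (d C k))
        ≡⟨ ∑-cong (λ x → cong (λ t → ⟦ t ⟧ * (d C k)) (S⊆V x)) (allVecs (suc d)) ⟩
      ∑[ x ∈ allVecs (suc d) ] (⟦ S x ⟧ * (d C k))
        ≡⟨ ∑-*ʳ (d C k) (λ x → ⟦ S x ⟧) (allVecs (suc d)) ⟩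
      ∑[ x ∈ allVecs (suc d) ] ⟦ S x ⟧ * (d C k)
        ≡⟨ cong (_* (d C k)) (count≡∑ S (allVecs (suc d))) ⟨
      card S * (d C k) ∎
      where
      open ≡-Reasoning
      ∧-not≡∧-xor : ∀ a c → a ∧ not c ≡ a ∧ (a xor c)
      ∧-not≡∧-xor true  c = refl
      ∧-not≡∧-xor false c = refl
      S⊆V : ∀ x → S x ∧ inComp (suc k) b x ≡ S x
      S⊆V x = trans (∧-assoc (eqB (lookup x j) c) _ _) (cong (eqB (lookup x j) c ∧_) (∧-idem _))

    ∑²-adjacent-across≤ : (D : Subset (suc d)) →
      ∑² (λ x y → ⟦ adj x y ∧ (D x ∧ (S x xor S y)) ⟧) ≤ card D * (d C k)
    ∑²-adjacent-across≤ D = begin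
      ∑² (λ x y → ⟦ adj x y ∧ (D x ∧ (S x xor S y)) ⟧)
        ≡⟨ ∑-cong (∑-adjacent-across D) (allVecs (suc d)) ⟩
      ∑[ x ∈ allVecs (suc d) ] (⟦ D x ∧ inComp (suc k) b x ⟧ * (d C k))
        ≤⟨ ∑-mono-≤ (λ x → *-monoˡ-≤ (d C k) (⟦∧⟧≤⟦⟧ (D x) _)) (allVecs (suc d)) ⟩
      ∑[ x ∈ allVecs (suc d) ] (⟦ D x ⟧ * (d C k))
        ≡⟨ ∑-*ʳ (d C k) (λ x → ⟦ D x ⟧) (allVecs (suc d)) ⟩
      ∑[ x ∈ allVecs (suc d) ] ⟦ D x ⟧ * (d C k)
        ≡⟨ cong (_* (d C k)) (count≡∑ D (allVecs (suc d))) ⟨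
      card D * (d C k) ∎
      where open ≤-Reasoning

    boundary-△-coordCut : (A : Subset (suc d)) →
      boundarySize (suc d) (suc k) b (A △ S) + card A * (d C k) ≤
        boundarySize (suc d) (suc k) b A + 3 * (card (A △ S) * (d C k))
    boundary-△-coordCut A = begin
      ∂ D + card A * N
        ≤⟨ +-monoʳ-≤ (∂ D) (*-monoˡ-≤ N (card≤card+card-△ A S)) ⟩
      ∂ D + (card S + card D) * N
        ≡⟨ cong (∂ D +_) (*-distribʳ-+ N (card S) (card D)) ⟩
      ∂ D + (card S * N + card D * N)
        ≡⟨ +-assoc (∂ D) (card S * N) (card D * N) ⟨
      ∂ D + card S * N + card D * N
        ≡⟨ cong (λ t → ∂ D + t + card D * N) boundarySize-coordCut ⟨
      ∂ D + ∂ S + card D * N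
        ≤⟨ +-monoˡ-≤ (card D * N) (boundary-△-≤ (suc k) b A S) ⟩
      ∂ A + 2 * ∑² (λ x y → ⟦ adj x y ∧ (D x ∧ (S x xor S y)) ⟧) + card D * N
        ≤⟨ +-monoˡ-≤ (card D * N) (+-monoʳ-≤ (∂ A) (*-monoʳ-≤ 2 (∑²-adjacent-across≤ D))) ⟩
      ∂ A + 2 * (card D * N) + card D * N
        ≡⟨ trans (+-assoc (∂ A) _ _) (cong (∂ A +_) (+-comm (2 * (card D * N)) (card D * N))) ⟩
      ∂ A + 3 * (card D * N) ∎
      where
      open ≤-Reasoning
      D : Subset (suc d)
      D = A △ S
      N : ℕ
      N = d C k
      ∂ : Subset (suc d) → ℕ
      ∂ = boundarySize (suc d) (suc k) b

module Rationals where
  open import Data.Nat as ℕ using (ℕ)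
  import Data.Nat.Coprimality as Coprimality
  open import Data.Integer using (+_)
  import Data.Integer as ℤ
  import Data.Integer.Properties as ℤ
  open import Data.Rational
  open import Data.Rational.Properties
  open import Data.Rational.Solver using (module +-*-Solver)
  open import Relation.Binary.PropositionalEquality
  open +-*-Solver

  ℕ→ℚ≡mkℚ : ∀ n → ℕ→ℚ n ≡ mkℚ (+ n) 0 (Coprimality.sym (Coprimality.1-coprimeTo n))
  ℕ→ℚ≡mkℚ n = normalize-coprime (Coprimality.sym (Coprimality.1-coprimeTo n))

  ℕ→ℚ-+ : ∀ m n → ℕ→ℚ (m ℕ.+ n) ≡ ℕ→ℚ m + ℕ→ℚ n
  ℕ→ℚ-+ m n rewrite ℕ→ℚ≡mkℚ m | ℕ→ℚ≡mkℚ n =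
    cong (_/ 1) (trans (ℤ.pos-+ m n) (sym (cong₂ ℤ._+_ (ℤ.*-identityʳ (+ m)) (ℤ.*-identityʳ (+ n)))))

  ℕ→ℚ-* : ∀ m n → ℕ→ℚ (m ℕ.* n) ≡ ℕ→ℚ m * ℕ→ℚ n
  ℕ→ℚ-* m n rewrite ℕ→ℚ≡mkℚ m | ℕ→ℚ≡mkℚ n = cong (_/ 1) (ℤ.pos-* m n)

  ℕ→ℚ-mono-≤ : ∀ {m n} → m ℕ.≤ n → ℕ→ℚ m ≤ ℕ→ℚ n
  ℕ→ℚ-mono-≤ {m} {n} m≤n rewrite ℕ→ℚ≡mkℚ m | ℕ→ℚ≡mkℚ n =
    *≤* (subst₂ ℤ._≤_ (sym (ℤ.*-identityʳ (+ m))) (sym (ℤ.*-identityʳ (+ n))) (ℤ.+≤+ m≤n))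

  ℕ→ℚ-nonNeg : ∀ n → NonNegative (ℕ→ℚ n)
  ℕ→ℚ-nonNeg n = nonNegative (ℕ→ℚ-mono-≤ {0} {n} ℕ.z≤n)

  ⊔0-nonNeg : ∀ K → NonNegative (K ⊔ 0ℚ)
  ⊔0-nonNeg K = nonNegative (p≤q⊔p K 0ℚ)

  boundaryConstant : ℚ → ℚ
  boundaryConstant K = 1ℚ + ℕ→ℚ 12 * (K ⊔ 0ℚ)

  0≤boundaryConstant*ε*n : ∀ K ε → 0ℚ ≤ ε → ∀ n → ℕ→ℚ 0 ≤ boundaryConstant K * ε * ℕ→ℚ n
  0≤boundaryConstant*ε*n K ε 0≤ε n = nonNegative⁻¹ _ {{Cεn≥0}}
    where
    12K⁺≥0 : NonNegative (ℕ→ℚ 12 * (K ⊔ 0ℚ))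
    12K⁺≥0 = nonNeg*nonNeg⇒nonNeg (ℕ→ℚ 12) {{ℕ→ℚ-nonNeg 12}} (K ⊔ 0ℚ) {{⊔0-nonNeg K}}
    C≥0 : NonNegative (boundaryConstant K)
    C≥0 = nonNeg+nonNeg⇒nonNeg 1ℚ (ℕ→ℚ 12 * (K ⊔ 0ℚ)) {{12K⁺≥0}}
    Cε≥0 : NonNegative (boundaryConstant K * ε)
    Cε≥0 = nonNeg*nonNeg⇒nonNeg (boundaryConstant K) {{C≥0}} ε {{nonNegative 0≤ε}}
    Cεn≥0 : NonNegative (boundaryConstant K * ε * ℕ→ℚ n)
    Cεn≥0 = nonNeg*nonNeg⇒nonNeg (boundaryConstant K * ε) {{Cε≥0}} (ℕ→ℚ n) {{ℕ→ℚ-nonNeg n}}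

  boundary-bound : (K ε : ℚ) → 0ℚ ≤ ε → (∂A ∂D N a δ n : ℕ) →
    ∂D ℕ.+ a ℕ.* N ℕ.≤ ∂A ℕ.+ 3 ℕ.* (δ ℕ.* N) →
    n ℕ.≤ 4 ℕ.* a →
    ℕ→ℚ ∂A ≤ (1ℚ + ε) * ℕ→ℚ (N ℕ.* a) →
    ℕ→ℚ δ ≤ K * ε * ℕ→ℚ n →
    ℕ→ℚ ∂D ≤ boundaryConstant K * ε * ℕ→ℚ (N ℕ.* a)
  boundary-bound K ε 0≤ε ∂A ∂D N a δ n counting n≤4a ∂A≤ δ≤ = begin
    ℕ→ℚ ∂D
      ≡⟨ solve 2 (λ x p → x := x :+ p :- p) refl (ℕ→ℚ ∂D) P ⟩
    ℕ→ℚ ∂D + P - P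
      ≤⟨ +-monoˡ-≤ (- P) ∂D+P≤ ⟩
    (1ℚ + ε) * P + ℕ→ℚ 3 * (K⁺ * ε * (ℕ→ℚ 4 * ℕ→ℚ a) * ℕ→ℚ N) - P
      ≡⟨ solve 6 (λ e k a′ n′ three four →
           (con 1ℚ :+ e) :* (n′ :* a′) :+ three :* (k :* e :* (four :* a′) :* n′) :- n′ :* a′
             := (con 1ℚ :+ three :* four :* k) :* e :* (n′ :* a′))
           refl ε K⁺ (ℕ→ℚ a) (ℕ→ℚ N) (ℕ→ℚ 3) (ℕ→ℚ 4) ⟩
    (1ℚ + ℕ→ℚ 3 * ℕ→ℚ 4 * K⁺) * ε * P
      ≡⟨ cong₂ (λ t u → (1ℚ + t * K⁺) * ε * u) (ℕ→ℚ-* 3 4) (ℕ→ℚ-* N a) ⟨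
    boundaryConstant K * ε * ℕ→ℚ (N ℕ.* a) ∎
    where
    open ≤-Reasoning
    K⁺ P : ℚ
    K⁺ = K ⊔ 0ℚ
    P = ℕ→ℚ N * ℕ→ℚ a

    δ≤4K⁺εa : ℕ→ℚ δ ≤ K⁺ * ε * (ℕ→ℚ 4 * ℕ→ℚ a)
    δ≤4K⁺εa = begin
      ℕ→ℚ δ
        ≤⟨ δ≤ ⟩
      K * ε * ℕ→ℚ n
        ≤⟨ *-monoʳ-≤-nonNeg (ℕ→ℚ n) {{ℕ→ℚ-nonNeg n}}
             (*-monoʳ-≤-nonNeg ε {{nonNegative 0≤ε}} (p≤p⊔q K 0ℚ)) ⟩
      K⁺ * ε * ℕ→ℚ n
        ≤⟨ *-monoˡ-≤-nonNeg (K⁺ * ε) {{nonNeg*nonNeg⇒nonNeg K⁺ {{⊔0-nonNeg K}} ε {{nonNegative 0≤ε}}}}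
             (ℕ→ℚ-mono-≤ n≤4a) ⟩
      K⁺ * ε * ℕ→ℚ (4 ℕ.* a)
        ≡⟨ cong (K⁺ * ε *_) (ℕ→ℚ-* 4 a) ⟩
      K⁺ * ε * (ℕ→ℚ 4 * ℕ→ℚ a) ∎

    ∂D+P≤ : ℕ→ℚ ∂D + P ≤ (1ℚ + ε) * P + ℕ→ℚ 3 * (K⁺ * ε * (ℕ→ℚ 4 * ℕ→ℚ a) * ℕ→ℚ N)
    ∂D+P≤ = begin
      ℕ→ℚ ∂D + P
        ≡⟨ cong (λ t → ℕ→ℚ ∂D + t) (trans (ℕ→ℚ-* a N) (*-comm (ℕ→ℚ a) (ℕ→ℚ N))) ⟨
      ℕ→ℚ ∂D + ℕ→ℚ (a ℕ.* N)
        ≡⟨ ℕ→ℚ-+ ∂D (a ℕ.* N) ⟨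
      ℕ→ℚ (∂D ℕ.+ a ℕ.* N)
        ≤⟨ ℕ→ℚ-mono-≤ counting ⟩
      ℕ→ℚ (∂A ℕ.+ 3 ℕ.* (δ ℕ.* N))
        ≡⟨ trans (ℕ→ℚ-+ ∂A (3 ℕ.* (δ ℕ.* N)))
             (cong (λ t → ℕ→ℚ ∂A + t) (trans (ℕ→ℚ-* 3 (δ ℕ.* N)) (cong (ℕ→ℚ 3 *_) (ℕ→ℚ-* δ N)))) ⟩
      ℕ→ℚ ∂A + ℕ→ℚ 3 * (ℕ→ℚ δ * ℕ→ℚ N)
        ≤⟨ +-mono-≤ (subst (ℕ→ℚ ∂A ≤_) (cong ((1ℚ + ε) *_) (ℕ→ℚ-* N a)) ∂A≤)
             (*-monoˡ-≤-nonNeg (ℕ→ℚ 3) {{ℕ→ℚ-nonNeg 3}} (*-monoʳ-≤-nonNeg (ℕ→ℚ N) {{ℕ→ℚ-nonNeg N}} δ≤4K⁺εa)) ⟩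
      (1ℚ + ε) * P + ℕ→ℚ 3 * (K⁺ * ε * (ℕ→ℚ 4 * ℕ→ℚ a) * ℕ→ℚ N) ∎

open import Data.Bool using (Bool)
open import Data.Nat using (ℕ; zero; suc; _∸_; _^_) renaming (_≤_ to _≤ℕ_; _*_ to _*ℕ_)
open import Data.Nat.Combinatorics using (_C_)
open import Data.Fin using (Fin)
open import Data.Product using (Σ; _×_; _,_)
open import Data.Rational using (ℚ; _≤_; _+_; _*_; 0ℚ; 1ℚ)
open import Relation.Binary.PropositionalEquality using (_≡_; sym; subst)
open HammingGraph
  using (boundarySize-k≡0; boundary-△-coordCut; 2^[1+d]≤4*card; boundarySymDiffSize≡boundarySize-△)
open Rationals using (boundaryConstant; 0≤boundaryConstant*ε*n; boundary-bound)

boundary-△-coordCut≤ : (K ε : ℚ) → 0ℚ ≤ ε → (d k : ℕ) (b : Bool) (A : Subset d) →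
  2 *ℕ card A ≡ card (Vset d k b) →
  ℕ→ℚ (boundarySize d k b A) ≤ (1ℚ + ε) * ℕ→ℚ (((d ∸ 1) C (k ∸ 1)) *ℕ card A) →
  (j : Fin d) (c : Bool) → ℕ→ℚ (card (A △ coordCut k b j c)) ≤ K * ε * ℕ→ℚ (2 ^ d) →
  ℕ→ℚ (boundarySize d k b (A △ coordCut k b j c)) ≤ boundaryConstant K * ε * ℕ→ℚ (((d ∸ 1) C (k ∸ 1)) *ℕ card A)
boundary-△-coordCut≤ K ε 0≤ε (suc d) zero b A _ _ j c _ =
  subst (λ n → ℕ→ℚ n ≤ boundaryConstant K * ε * ℕ→ℚ ((d C 0) *ℕ card A))
    (sym (boundarySize-k≡0 (suc d) b (A △ coordCut zero b j c)))
    (0≤boundaryConstant*ε*n K ε 0≤ε ((d C 0) *ℕ card A))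
boundary-△-coordCut≤ K ε 0≤ε (suc d) (suc k) b A 2|A|≡|V| ∂A≤ j c |A△S|≤ =
  boundary-bound K ε 0≤ε (boundarySize (suc d) (suc k) b A) (boundarySize (suc d) (suc k) b D)
    (d C k) (card A) (card D) (2 ^ suc d)
    (boundary-△-coordCut k b j c A) (2^[1+d]≤4*card d (suc k) b A 2|A|≡|V|) ∂A≤ |A△S|≤
  where
  D : Subset (suc d)
  D = A △ coordCut (suc k) b j c

lemma15 : (K : ℚ)
    → ((k : ℕ) → 1 ≤ℕ k → Σ ℕ (λ d₀ → (d : ℕ) → d₀ ≤ℕ d → (b : Bool) → (ε : ℚ) → 0ℚ ≤ ε
        → (A : Subset d) → A ⊆V[ k , b ] → 2 *ℕ card A ≡ card (Vset d k b)
        → ℕ→ℚ (boundarySize d k b A) ≤ (1ℚ + ε) * ℕ→ℚ (((d ∸ 1) C (k ∸ 1)) *ℕ card A)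
        → Σ (Fin d) (λ j → Σ Bool (λ c →
            ℕ→ℚ (card (A △ coordCut k b j c)) ≤ K * ε * ℕ→ℚ (2 ^ d)))))
    → Σ ℚ (λ Cst → (d k : ℕ) → (b : Bool) → (ε : ℚ) → 0ℚ ≤ ε
        → (A : Subset d) → A ⊆V[ k , b ] → 2 *ℕ card A ≡ card (Vset d k b)
        → ℕ→ℚ (boundarySize d k b A) ≤ (1ℚ + ε) * ℕ→ℚ (((d ∸ 1) C (k ∸ 1)) *ℕ card A)
        → (j : Fin d) → (c : Bool)
        → ℕ→ℚ (card (A △ coordCut k b j c)) ≤ K * ε * ℕ→ℚ (2 ^ d)
        → (boundarySymDiffSize d k b A (coordCut k b j c)
             ≡ boundarySize d k b (A △ coordCut k b j c))
          × (ℕ→ℚ (boundarySize d k b (A △ coordCut k b j c))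
             ≤ Cst * ε * ℕ→ℚ (((d ∸ 1) C (k ∸ 1)) *ℕ card A)))
lemma15 K _ = boundaryConstant K , λ d k b ε 0≤ε A _ 2|A|≡|V| ∂A≤ j c |A△S|≤ →
  boundarySymDiffSize≡boundarySize-△ k b A (coordCut k b j c) ,
  boundary-△-coordCut≤ K ε 0≤ε d k b A 2|A|≡|V| ∂A≤ j c |A△S|≤
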